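{- Let $\mathcal A$ be a category with binary coproducts, $H$ an endofunctor of $\mathcal A$, and $(A,\alpha)$ a completely iterative $H$-algebra, with $e\mapsto e^\dagger$ the assignment of unique solutions. Then this assignment is compositional: for all flat equation morphisms $e:X\to HX+Y$ and $f:Y\to HY+A$, we have $(f^\dagger\bullet e)^\dagger=(f\oplus e)^\dagger\cdot\mathrm{inl}$.
   Context: Coproduct injections are $\mathrm{inl},\mathrm{inr}$. An $H$-algebra is $\alpha:HA\to A$. A flat equation morphism in an object $B$ is a morphism $e:X\to HX+B$; for $A$ an $H$-algebra a solution of $e:X\to HX+A$ is $e^\dagger:X\to A$ with $e^\dagger=[\alpha,\mathrm{id}_A]\cdot(He^\dagger+\mathrm{id}_A)\cdot e$; $A$ is completely iterative if every such $e$ has a unique solution. For $e:X\to HX+Y$ and $h:Y\to Z$, $h\bullet e:=(\mathrm{id}_{HX}+h)\cdot e:X\to HX+Z$. For $e:X\to HX+Y$ and $f:Y\to HY+A$, $f\oplus e: X+Y\to H(X+Y)+A$ is the composite $(\mathrm{can}+\mathrm{id}_A)\cdot(\mathrm{id}_{HX}+f)\cdot[e,\mathrm{inr}]$, where $\mathrm{can}=[H\mathrm{inl},H\mathrm{inr}]:HX+HY\to H(X+Y)$. -}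

module Defs where

open import Level using (Level; _⊔_; suc)
open import Relation.Binary using (IsEquivalence)

record Category (o ℓ e : Level) : Set (suc (o ⊔ ℓ ⊔ e)) where
  infixr 9 _∘_
  infix  4 _≈_
  infix  4 _⇒_
  field
    Obj       : Set o
    _⇒_       : Obj → Obj → Set ℓ
    _≈_       : ∀ {A B} → A ⇒ B → A ⇒ B → Set e
    id        : ∀ {A} → A ⇒ A
    _∘_       : ∀ {A B C} → B ⇒ C → A ⇒ B → A ⇒ C
    equiv     : ∀ {A B} → IsEquivalence (_≈_ {A} {B})
    assoc     : ∀ {A B C D} {f : A ⇒ B} {g : B ⇒ C} {h : C ⇒ D} →
                (h ∘ g) ∘ f ≈ h ∘ (g ∘ f)
    identityˡ : ∀ {A B} {f : A ⇒ B} → id ∘ f ≈ f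
    identityʳ : ∀ {A B} {f : A ⇒ B} → f ∘ id ≈ f
    ∘-resp-≈  : ∀ {A B C} {f h : B ⇒ C} {g i : A ⇒ B} →
                f ≈ h → g ≈ i → f ∘ g ≈ h ∘ i

record BinaryCoproducts {o ℓ e} (C : Category o ℓ e) : Set (o ⊔ ℓ ⊔ e) where
  open Category C
  infixr 6 _+_
  field
    _+_    : Obj → Obj → Obj
    inl    : ∀ {A B} → A ⇒ A + B
    inr    : ∀ {A B} → B ⇒ A + B
    [_,_]  : ∀ {A B Z} → A ⇒ Z → B ⇒ Z → A + B ⇒ Z
    inject₁ : ∀ {A B Z} {f : A ⇒ Z} {g : B ⇒ Z} → [ f , g ] ∘ inl ≈ f
    inject₂ : ∀ {A B Z} {f : A ⇒ Z} {g : B ⇒ Z} → [ f , g ] ∘ inr ≈ g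
    unique  : ∀ {A B Z} {h : A + B ⇒ Z} {f : A ⇒ Z} {g : B ⇒ Z} →
              h ∘ inl ≈ f → h ∘ inr ≈ g → [ f , g ] ≈ h

  infixr 6 _+₁_
  _+₁_ : ∀ {A B A' B'} → A ⇒ A' → B ⇒ B' → A + B ⇒ A' + B'
  f +₁ g = [ inl ∘ f , inr ∘ g ]

  assocˡ : ∀ {A B D} → A + (B + D) ⇒ (A + B) + D
  assocˡ = [ inl ∘ inl , [ inl ∘ inr , inr ] ]

record Endofunctor {o ℓ e} (C : Category o ℓ e) : Set (o ⊔ ℓ ⊔ e) where
  open Category C
  field
    F₀           : Obj → Obj
    F₁           : ∀ {A B} → A ⇒ B → F₀ A ⇒ F₀ B
    identity     : ∀ {A} → F₁ (id {A}) ≈ id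
    homomorphism : ∀ {A B D} {f : A ⇒ B} {g : B ⇒ D} →
                   F₁ (g ∘ f) ≈ F₁ g ∘ F₁ f
    F-resp-≈     : ∀ {A B} {f g : A ⇒ B} → f ≈ g → F₁ f ≈ F₁ g

module Iteration {o ℓ e} (C : Category o ℓ e) (CP : BinaryCoproducts C)
                 (H : Endofunctor C) where
  open Category C
  open BinaryCoproducts CP
  open Endofunctor H

  record Algebra : Set (o ⊔ ℓ) where
    field
      Carrier : Obj
      α       : F₀ Carrier ⇒ Carrier

  FlatEqn : Obj → Obj → Set ℓ
  FlatEqn X B = X ⇒ F₀ X + B

  IsSolution : (𝔸 : Algebra) → let A = Algebra.Carrier 𝔸 in
               ∀ {X} → FlatEqn X A → X ⇒ A → Set e
  IsSolution 𝔸 {X} eq s =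
    s ≈ [ Algebra.α 𝔸 , id ] ∘ (F₁ s +₁ id) ∘ eq

  record CompletelyIterative (𝔸 : Algebra) : Set (o ⊔ ℓ ⊔ e) where
    open Algebra 𝔸
    field
      _†         : ∀ {X} → FlatEqn X Carrier → X ⇒ Carrier
      †-solution : ∀ {X} (eq : FlatEqn X Carrier) → IsSolution 𝔸 eq (eq †)
      †-unique   : ∀ {X} (eq : FlatEqn X Carrier) (s : X ⇒ Carrier) →
                   IsSolution 𝔸 eq s → s ≈ eq †

  _•_ : ∀ {X Y Z} → Y ⇒ Z → FlatEqn X Y → FlatEqn X Z
  h • eq = (id +₁ h) ∘ eq

  can : ∀ {X Y} → F₀ X + F₀ Y ⇒ F₀ (X + Y)
  can = [ F₁ inl , F₁ inr ]

  -- f ⊕ e : X + Y → H(X + Y) + A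
  --   = (can + id) · assoc · (id + f) · [e, inr]
  -- (assoc : HX + (HY + A) ≅ (HX + HY) + A is left implicit in the paper)
  _⊕_ : ∀ {X Y A} → FlatEqn Y A → FlatEqn X Y → FlatEqn (X + Y) A
  f ⊕ eq = (can +₁ id) ∘ assocˡ ∘ (id +₁ f) ∘ [ eq , inr ]

{-# OPTIONS --safe #-}
module Submission where

-- Let s be the solution of f ⊕ e. Unfolding its solution equation along the
-- coproduct X + Y shows that s ∘ inr solves f, so s ∘ inr ≈ f †, and that
-- s ∘ inl ≈ [ α ∘ F₁ (s ∘ inl) , s ∘ inr ] ∘ e, which after replacing s ∘ inr
-- by f † is the solution equation of f † • e.

open import Level using (Level)
open import Relation.Binary using (Setoid)
import Relation.Binary.Reasoning.Setoid as SetoidReasoning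
open import Defs

module CategoryLaws {o ℓ e} (C : Category o ℓ e) where
  open Category C

  hom-setoid : Obj → Obj → Setoid ℓ e
  hom-setoid A B = record { Carrier = A ⇒ B ; _≈_ = _≈_ ; isEquivalence = equiv }

  module _ {A B : Obj} where
    open Setoid (hom-setoid A B) public
      using () renaming (refl to ≈-refl; sym to ≈-sym; trans to ≈-trans)

  module HomReasoning {A B : Obj} = SetoidReasoning (hom-setoid A B)

  ∘-resp-≈ˡ : ∀ {A B D} {f h : B ⇒ D} {g : A ⇒ B} → f ≈ h → f ∘ g ≈ h ∘ g
  ∘-resp-≈ˡ p = ∘-resp-≈ p ≈-refl

  ∘-resp-≈ʳ : ∀ {A B D} {f : B ⇒ D} {g i : A ⇒ B} → g ≈ i → f ∘ g ≈ f ∘ i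
  ∘-resp-≈ʳ p = ∘-resp-≈ ≈-refl p

  pullˡ : ∀ {A B D E} {a : D ⇒ E} {b : B ⇒ D} {c : B ⇒ E} {d : A ⇒ B} →
          a ∘ b ≈ c → a ∘ (b ∘ d) ≈ c ∘ d
  pullˡ p = ≈-trans (≈-sym assoc) (∘-resp-≈ˡ p)

  pullʳ : ∀ {A B D E} {a : D ⇒ E} {b : B ⇒ D} {c : A ⇒ B} {d : A ⇒ D} →
          b ∘ c ≈ d → (a ∘ b) ∘ c ≈ a ∘ d
  pullʳ p = ≈-trans assoc (∘-resp-≈ʳ p)

module CoproductLaws {o ℓ e} (C : Category o ℓ e) (CP : BinaryCoproducts C) where
  open Category C
  open BinaryCoproducts CP
  open CategoryLaws C

  ∘[] : ∀ {A B Z W} {h : Z ⇒ W} {f : A ⇒ Z} {g : B ⇒ Z} →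
        h ∘ [ f , g ] ≈ [ h ∘ f , h ∘ g ]
  ∘[] = ≈-sym (unique (pullʳ inject₁) (pullʳ inject₂))

  []-cong₂ : ∀ {A B Z} {f f' : A ⇒ Z} {g g' : B ⇒ Z} →
             f ≈ f' → g ≈ g' → [ f , g ] ≈ [ f' , g' ]
  []-cong₂ p q = ≈-sym (unique (≈-trans inject₁ p) (≈-trans inject₂ q))

  []∘+₁ : ∀ {A B A' B' Z} {f : A' ⇒ Z} {g : B' ⇒ Z} {a : A ⇒ A'} {b : B ⇒ B'} →
          [ f , g ] ∘ (a +₁ b) ≈ [ f ∘ a , g ∘ b ]
  []∘+₁ = ≈-trans ∘[] ([]-cong₂ (pullˡ inject₁) (pullˡ inject₂))

  []∘assocˡ : ∀ {A B D Z} {a : A ⇒ Z} {b : B ⇒ Z} {c : D ⇒ Z} →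
              [ [ a , b ] , c ] ∘ assocˡ ≈ [ a , [ b , c ] ]
  []∘assocˡ = ≈-trans ∘[] ([]-cong₂
    (≈-trans (pullˡ inject₁) inject₁)
    (≈-trans ∘[] ([]-cong₂ (≈-trans (pullˡ inject₁) inject₂) inject₂)))

module Solutions {o ℓ e} (C : Category o ℓ e) (CP : BinaryCoproducts C)
                 (H : Endofunctor C) (𝔸 : Iteration.Algebra C CP H) where
  open Category C
  open BinaryCoproducts CP
  open Endofunctor H
  open Iteration C CP H
  open Algebra 𝔸
  open CategoryLaws C
  open CoproductLaws C CP
  open HomReasoning

  [α,id]∘F₁+₁id : ∀ {X Z} {s : X ⇒ Carrier} {g : Z ⇒ F₀ X + Carrier} →
                  [ α , id ] ∘ (F₁ s +₁ id) ∘ g ≈ [ α ∘ F₁ s , id ] ∘ g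
  [α,id]∘F₁+₁id = pullˡ (≈-trans []∘+₁ ([]-cong₂ ≈-refl identityˡ))

  solution-unfold : ∀ {X} {eq : FlatEqn X Carrier} {s : X ⇒ Carrier} →
                    IsSolution 𝔸 eq s → s ≈ [ α ∘ F₁ s , id ] ∘ eq
  solution-unfold sol = ≈-trans sol [α,id]∘F₁+₁id

  solution-fold : ∀ {X} {eq : FlatEqn X Carrier} {s : X ⇒ Carrier} →
                  s ≈ [ α ∘ F₁ s , id ] ∘ eq → IsSolution 𝔸 eq s
  solution-fold p = ≈-trans p (≈-sym [α,id]∘F₁+₁id)

  solution-• : ∀ {X Y} {e : FlatEqn X Y} {h : Y ⇒ Carrier} {t : X ⇒ Carrier} →
               t ≈ [ α ∘ F₁ t , h ] ∘ e → IsSolution 𝔸 (h • e) t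
  solution-• {e = e} {h} {t} p = solution-fold (begin
    t                                   ≈⟨ p ⟩
    [ α ∘ F₁ t , h ] ∘ e                ≈⟨ pullˡ (≈-trans []∘+₁ ([]-cong₂ identityʳ identityˡ)) ⟨
    [ α ∘ F₁ t , id ] ∘ (id +₁ h) ∘ e   ∎)

  F₁∘can : ∀ {X Y Z} {s : X + Y ⇒ Z} → F₁ s ∘ can ≈ [ F₁ (s ∘ inl) , F₁ (s ∘ inr) ]
  F₁∘can = ≈-trans ∘[] ([]-cong₂ (≈-sym homomorphism) (≈-sym homomorphism))

  [α∘F₁,id]∘⊕ : ∀ {X Y} (s : X + Y ⇒ Carrier) (e : FlatEqn X Y) (f : FlatEqn Y Carrier) →
                [ α ∘ F₁ s , id ] ∘ (f ⊕ e)
                  ≈ [ [ α ∘ F₁ (s ∘ inl) , [ α ∘ F₁ (s ∘ inr) , id ] ∘ f ] ∘ e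
                    , [ α ∘ F₁ (s ∘ inr) , id ] ∘ f ]
  [α∘F₁,id]∘⊕ s e f = begin
    [ α ∘ F₁ s , id ] ∘ (can +₁ id) ∘ assocˡ ∘ (id +₁ f) ∘ [ e , inr ]
      ≈⟨ pullˡ (≈-trans []∘+₁ ([]-cong₂ α∘F₁∘can identityˡ)) ⟩
    [ [ α ∘ F₁ sl , α ∘ F₁ sr ] , id ] ∘ assocˡ ∘ (id +₁ f) ∘ [ e , inr ]
      ≈⟨ pullˡ []∘assocˡ ⟩
    [ α ∘ F₁ sl , [ α ∘ F₁ sr , id ] ] ∘ (id +₁ f) ∘ [ e , inr ]
      ≈⟨ pullˡ (≈-trans []∘+₁ ([]-cong₂ identityʳ ≈-refl)) ⟩
    [ α ∘ F₁ sl , [ α ∘ F₁ sr , id ] ∘ f ] ∘ [ e , inr ]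
      ≈⟨ ≈-trans ∘[] ([]-cong₂ ≈-refl inject₂) ⟩
    [ [ α ∘ F₁ sl , [ α ∘ F₁ sr , id ] ∘ f ] ∘ e , [ α ∘ F₁ sr , id ] ∘ f ] ∎
    where
    sl = s ∘ inl
    sr = s ∘ inr
    α∘F₁∘can : (α ∘ F₁ s) ∘ can ≈ [ α ∘ F₁ sl , α ∘ F₁ sr ]
    α∘F₁∘can = ≈-trans assoc (≈-trans (∘-resp-≈ʳ F₁∘can) ∘[])

  module _ {X Y} {e : FlatEqn X Y} {f : FlatEqn Y Carrier} {s : X + Y ⇒ Carrier}
           (sol : IsSolution 𝔸 (f ⊕ e) s) where

    private
      s-split : s ≈ [ [ α ∘ F₁ (s ∘ inl) , [ α ∘ F₁ (s ∘ inr) , id ] ∘ f ] ∘ e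
                    , [ α ∘ F₁ (s ∘ inr) , id ] ∘ f ]
      s-split = ≈-trans (solution-unfold sol) ([α∘F₁,id]∘⊕ s e f)

      s∘inr-unfold : s ∘ inr ≈ [ α ∘ F₁ (s ∘ inr) , id ] ∘ f
      s∘inr-unfold = ≈-trans (∘-resp-≈ˡ s-split) inject₂

    solution-⊕-inr : IsSolution 𝔸 f (s ∘ inr)
    solution-⊕-inr = solution-fold s∘inr-unfold

    solution-⊕-inl : s ∘ inl ≈ [ α ∘ F₁ (s ∘ inl) , s ∘ inr ] ∘ e
    solution-⊕-inl = ≈-trans (∘-resp-≈ˡ s-split)
      (≈-trans inject₁ (∘-resp-≈ˡ ([]-cong₂ ≈-refl (≈-sym s∘inr-unfold))))

module Compositionality {o ℓ e} (C : Category o ℓ e) (CP : BinaryCoproducts C)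
                        (H : Endofunctor C) (𝔸 : Iteration.Algebra C CP H)
                        (cia : Iteration.CompletelyIterative C CP H 𝔸) where
  open Category C
  open BinaryCoproducts CP
  open Endofunctor H
  open Iteration C CP H
  open Algebra 𝔸
  open CompletelyIterative cia
  open CategoryLaws C
  open CoproductLaws C CP
  open Solutions C CP H 𝔸
  open HomReasoning

  module _ {X Y} (e : FlatEqn X Y) (f : FlatEqn Y Carrier) where

    ⊕-†∘inr : (f ⊕ e) † ∘ inr ≈ f †
    ⊕-†∘inr = †-unique f _ (solution-⊕-inr (†-solution (f ⊕ e)))

    ⊕-†∘inl : (f ⊕ e) † ∘ inl ≈ ((f †) • e) †
    ⊕-†∘inl = †-unique ((f †) • e) sl (solution-• (begin
      sl                                 ≈⟨ solution-⊕-inl (†-solution (f ⊕ e)) ⟩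
      [ α ∘ F₁ sl , (f ⊕ e) † ∘ inr ] ∘ e  ≈⟨ ∘-resp-≈ˡ ([]-cong₂ ≈-refl ⊕-†∘inr) ⟩
      [ α ∘ F₁ sl , f † ] ∘ e              ∎))
      where
      sl = (f ⊕ e) † ∘ inl

lemma2p17 : ∀ {o ℓ e : Level} (C : Category o ℓ e) (CP : BinaryCoproducts C)
              (H : Endofunctor C) (𝔸 : Iteration.Algebra C CP H)
              (cia : Iteration.CompletelyIterative C CP H 𝔸)
              {X Y : Category.Obj C}
              (eq : Category._⇒_ C X (BinaryCoproducts._+_ CP (Endofunctor.F₀ H X) Y))
              (f : Category._⇒_ C Y (BinaryCoproducts._+_ CP (Endofunctor.F₀ H Y) (Iteration.Algebra.Carrier 𝔸))) →
              Category._≈_ C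
                (Iteration.CompletelyIterative._† cia
                  (Iteration._•_ C CP H (Iteration.CompletelyIterative._† cia f) eq))
                (Category._∘_ C
                  (Iteration.CompletelyIterative._† cia (Iteration._⊕_ C CP H f eq))
                  (BinaryCoproducts.inl CP))
lemma2p17 C CP H 𝔸 cia eq f =
  CategoryLaws.≈-sym C (Compositionality.⊕-†∘inl C CP H 𝔸 cia eq f)
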